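{- Let $G=(V,E)$ be a digraph such that every two distinct vertices $x,y\in V$ are adjacent (i.e., $(x,y)\in E$ or $(y,x)\in E$) and there are no bi-directional edges (no distinct $x,y$ with both $(x,y),(y,x)\in E$). Then $G$ is a Fitch graph if and only if $G$ is a directed acyclic graph.
   Context: All digraphs are finite and have irreflexive edge sets. A rooted tree is a finite directed tree with all edges directed away from a unique root, in which no non-root vertex has exactly one child; $\mathrm{lca}_T(x,y)$ denotes the least common ancestor of $x,y$. A digraph $G=(V,E)$ is a Fitch graph if it is isomorphic to a digraph $\mathbb{G}(T,\lambda)$, where $T$ is a rooted tree with leaf set $V$, $\lambda\colon E(T)\to\{0,1\}$, and $\mathbb{G}(T,\lambda)$ has vertex set $V$ and contains the edge $(x,y)$, for distinct $x,y\in V$, if and only if the unique path in $T$ from $\mathrm{lca}_T(x,y)$ to $y$ contains at least one edge labeled $1$. -}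

module Defs where

open import Data.Nat using (ℕ; zero; suc; _≤_; _≡ᵇ_)
open import Data.Bool using (Bool; true; false; if_then_else_)
open import Data.Fin using (Fin)
open import Data.List using (List; []; _∷_; _++_; length)
open import Data.List.Relation.Unary.All using (All)
open import Data.List.Relation.Unary.Any using (Any)
open import Data.List.Relation.Unary.Unique.Propositional using (Unique)
open import Data.List.Membership.Propositional using (_∈_)
open import Data.Product using (Σ; ∃; ∃-syntax; _×_; _,_; proj₁; proj₂)
open import Data.Sum using (_⊎_)
open import Function.Bundles using (_⤖_; _⇔_; Bijection)
open import Relation.Binary.PropositionalEquality using (_≡_; _≢_)
open import Relation.Binary.Construct.Closure.Transitive using (TransClosure)
open import Relation.Nullary using (¬_)

Digraph : ℕ → Set
Digraph n = Fin n → Fin n → Bool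

Arc : ∀ {n} → Digraph n → Fin n → Fin n → Set
Arc E x y = E x y ≡ true

Irreflexive : ∀ {n} → Digraph n → Set
Irreflexive E = ∀ x → ¬ Arc E x x

AllAdjacent : ∀ {n} → Digraph n → Set
AllAdjacent E = ∀ x y → x ≢ y → Arc E x y ⊎ Arc E y x

NoBidirectional : ∀ {n} → Digraph n → Set
NoBidirectional E = ∀ x y → x ≢ y → ¬ (Arc E x y × Arc E y x)

Acyclic : ∀ {n} → Digraph n → Set
Acyclic E = ∀ x → ¬ TransClosure (Arc E) x x

-- Rooted trees with leaves labelled by Fin m, and with every tree edge
-- (parent → child) labelled by a Bool (λ : E(T) → {0,1}, true = 1).

data Tree (m : ℕ) : Set where
  leaf : Fin m → Tree m
  node : List (Bool × Tree m) → Tree m   -- children, each with the label of the edge to it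

mutual
  leaves : ∀ {m} → Tree m → List (Fin m)
  leaves (leaf x)  = x ∷ []
  leaves (node cs) = leavesL cs

  leavesL : ∀ {m} → List (Bool × Tree m) → List (Fin m)
  leavesL []             = []
  leavesL ((_ , c) ∷ cs) = leaves c ++ leavesL cs

data NonRootOK {m : ℕ} : Tree m → Set where
  leafOK : ∀ x → NonRootOK (leaf x)
  nodeOK : ∀ cs → 2 ≤ length cs → All (λ bc → NonRootOK (proj₂ bc)) cs → NonRootOK (node cs)

-- The root: if it is not a leaf, it has at least one child (a vertex
-- without children is a leaf); the root may have exactly one child.
data RootOK {m : ℕ} : Tree m → Set where
  leafOK : ∀ x → RootOK (leaf x)
  nodeOK : ∀ cs → 1 ≤ length cs → All (λ bc → NonRootOK (proj₂ bc)) cs → RootOK (node cs)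

record RootedTreeOn (m : ℕ) (T : Tree m) : Set where
  field
    shape    : RootOK T
    covers   : ∀ x → x ∈ leaves T
    distinct : Unique (leaves T)

-- A step of a root-to-leaf path: (index of the child, label of that edge).
Step : Set
Step = ℕ × Bool

data At {A : Set} : List A → ℕ → A → Set where
  at-zero : ∀ {a as} → At (a ∷ as) zero a
  at-suc  : ∀ {a b as i} → At as i a → At (b ∷ as) (suc i) a

data PathTo {m : ℕ} : Tree m → Fin m → List Step → Set where
  here : ∀ {y} → PathTo (leaf y) y []
  down : ∀ {cs i b c y p} → At cs i (b , c) → PathTo c y p → PathTo (node cs) y ((i , b) ∷ p)

-- Given the root paths to x and to y, the part of the path to y that
-- lies below lca(x,y): drop the longest common prefix (same child indices).
belowLca : List Step → List Step → List Step
belowLca ((i , _) ∷ p) ((j , b) ∷ q) = if i ≡ᵇ j then belowLca p q else (j , b) ∷ q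
belowLca _ q = q

-- The edge (x , y) of 𝔾(T, λ): x ≠ y and the path from lca(x,y) to y
-- contains an edge labelled 1.
FitchArc : ∀ {m} → Tree m → Fin m → Fin m → Set
FitchArc T x y =
  x ≢ y × ∃[ px ] ∃[ py ] (PathTo T x px × PathTo T y py ×
                           Any (λ s → proj₂ s ≡ true) (belowLca px py))

IsFitch : ∀ {n} → Digraph n → Set
IsFitch {n} E =
  ∃[ m ] ∃[ T ] (RootedTreeOn m T ×
    Σ (Fin n ⤖ Fin m) (λ f → ∀ x y →
       Arc E x y ⇔ FitchArc T (Bijection.to f x) (Bijection.to f y)))

-- Under the hypotheses G is a tournament, and both conditions are equivalent to
-- transitivity. A tournament is acyclic iff it has no directed triangle. A Fitch
-- graph has no induced directed triangle: write ℓ(x,y) for the depth of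
-- lca(x,y). An arc x → y without y → x means that the root path of y carries a 1
-- below depth ℓ(x,y) but the root path of x does not, so for a triangle
-- x → y → z → x with no reverse arcs the root path of y gives ℓ(x,y) < ℓ(y,z),
-- and going around, ℓ(x,y) < ℓ(y,z) < ℓ(z,x) < ℓ(x,y). Conversely, a transitive
-- tournament is a linear order x₁ < ⋯ < xₙ, realised by the caterpillar whose
-- spine edges are labelled 1 and in which xᵢ hangs by a 0-edge off the i-th
-- spine vertex.
module Submission where

open import Defs
open import Data.Bool using (Bool; true; false; if_then_else_)
open import Data.Empty using (⊥; ⊥-elim)
open import Data.Fin using (Fin) renaming (zero to fzero)
open import Data.Fin.Properties using (_≟_)
open import Data.List using (List; []; _∷_; _++_; drop; allFin)
open import Data.List.Properties using (++-identityʳ)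
open import Data.List.Membership.Propositional using (_∈_)
open import Data.List.Membership.Propositional.Properties using (∈-allFin; ∈-++⁺ˡ; ∈-++⁺ʳ)
open import Data.List.Relation.Binary.Permutation.Propositional using (↭-sym; ↭⇒↭ₛ)
open import Data.List.Relation.Binary.Permutation.Propositional.Properties using (∈-resp-↭)
import Data.List.Relation.Binary.Permutation.Setoid.Properties as ↭ₛ
open import Data.List.Relation.Unary.All as All using (All; []; _∷_)
import Data.List.Relation.Unary.All.Properties as All
open import Data.List.Relation.Unary.AllPairs as AllPairs using (AllPairs; []; _∷_)
open import Data.List.Relation.Unary.Any using (Any; here; there)
open import Data.List.Relation.Unary.Sorted.TotalOrder.Properties using (Sorted⇒AllPairs)
open import Data.List.Relation.Unary.Unique.Propositional using (Unique)
open import Data.List.Relation.Unary.Unique.Propositional.Properties using (allFin⁺)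
import Data.List.Sort
open import Data.Nat using (ℕ; zero; suc; _≡ᵇ_; _≤_; _<_; z≤n; s≤s)
open import Data.Nat.Properties using (≰⇒>; <-irrefl; <-trans)
open import Data.Product using (∃-syntax; _×_; _,_; proj₁; proj₂)
open import Data.Sum using (_⊎_; inj₁; inj₂)
open import Function using (_∘_)
open import Function.Bundles using (_⇔_; mk⇔; Bijection; Equivalence)
open import Function.Construct.Identity using (⤖-id)
open import Level using (Level)
open import Relation.Binary
  using (Rel; Transitive; Asymmetric; Trichotomous; StrictTotalOrder; tri<; tri≈; tri>)
import Relation.Binary.Properties.StrictTotalOrder as StrictTotalOrderProperties
open import Relation.Binary.Construct.Closure.Transitive using (_∷_; [_]; transitive⁻)
open import Relation.Binary.PropositionalEquality
  using (_≡_; _≢_; refl; sym; trans; cong; subst; resp₂; isEquivalence; setoid; ≢-sym)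
open import Relation.Nullary using (¬_; yes; no)

private
  variable
    a ℓ : Level
    A : Set a

≡ᵇ-comm : ∀ i j → (i ≡ᵇ j) ≡ (j ≡ᵇ i)
≡ᵇ-comm zero    zero    = refl
≡ᵇ-comm zero    (suc j) = refl
≡ᵇ-comm (suc i) zero    = refl
≡ᵇ-comm (suc i) (suc j) = ≡ᵇ-comm i j

lcaDepth : List Step → List Step → ℕ
lcaDepth ((i , _) ∷ p) ((j , _) ∷ q) = if i ≡ᵇ j then suc (lcaDepth p q) else zero
lcaDepth _             _             = zero

lcaDepth-comm : ∀ p q → lcaDepth p q ≡ lcaDepth q p
lcaDepth-comm []            []            = refl
lcaDepth-comm []            (_ ∷ _)       = refl
lcaDepth-comm (_ ∷ _)       []            = refl
lcaDepth-comm ((i , _) ∷ p) ((j , _) ∷ q) rewrite ≡ᵇ-comm i j with j ≡ᵇ i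
... | true  = cong suc (lcaDepth-comm p q)
... | false = refl

belowLca≡drop-lcaDepth : ∀ p q → belowLca p q ≡ drop (lcaDepth p q) q
belowLca≡drop-lcaDepth []            q             = refl
belowLca≡drop-lcaDepth (_ ∷ _)       []            = refl
belowLca≡drop-lcaDepth ((i , _) ∷ p) ((j , _) ∷ q) with i ≡ᵇ j
... | true  = belowLca≡drop-lcaDepth p q
... | false = refl

HasOne : List Step → Set
HasOne = Any (λ s → proj₂ s ≡ true)

Any-drop-antitone : ∀ {P : A → Set ℓ} {k l} xs → k ≤ l → Any P (drop l xs) → Any P (drop k xs)
Any-drop-antitone {k = zero}  {zero}  xs       _         p = p
Any-drop-antitone {k = zero}  {suc l} (_ ∷ xs) _         p = there (Any-drop-antitone {l = l} xs z≤n p)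
Any-drop-antitone {k = suc k} {suc l} (_ ∷ xs) (s≤s k≤l) p = Any-drop-antitone xs k≤l p

HasOne-drop-< : ∀ q k l → HasOne (drop k q) → ¬ HasOne (drop l q) → k < l
HasOne-drop-< q k l h ¬h = ≰⇒> (λ l≤k → ¬h (Any-drop-antitone q l≤k h))

belowLca-noTriangle : ∀ px py pz →
  HasOne (belowLca px py) → HasOne (belowLca py pz) → HasOne (belowLca pz px) →
  ¬ HasOne (belowLca py px) → ¬ HasOne (belowLca pz py) → ¬ HasOne (belowLca px pz) →
  ⊥
belowLca-noTriangle px py pz xy yz zx ¬yx ¬zy ¬xz =
  <-irrefl refl
    (<-trans (deeper py px pz xy ¬zy) (<-trans (deeper pz py px yz ¬xz) (deeper px pz py zx ¬yx)))
  where
  deeper : ∀ p q r → HasOne (belowLca q p) → ¬ HasOne (belowLca r p) → lcaDepth q p < lcaDepth p r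
  deeper p q r h ¬h = HasOne-drop-< p (lcaDepth q p) (lcaDepth p r) h′ ¬h′
    where
    h′ : HasOne (drop (lcaDepth q p) p)
    h′ = subst HasOne (belowLca≡drop-lcaDepth q p) h

    ¬h′ : ¬ HasOne (drop (lcaDepth p r) p)
    ¬h′ rewrite lcaDepth-comm p r | sym (belowLca≡drop-lcaDepth r p) = ¬h

AllPairs-++⁻ : ∀ {R : Rel A ℓ} xs {ys} → AllPairs R (xs ++ ys) →
  AllPairs R xs × AllPairs R ys × All (λ x → All (R x) ys) xs
AllPairs-++⁻ []       rs        = [] , rs , []
AllPairs-++⁻ (x ∷ xs) (rx ∷ rs) with AllPairs-++⁻ xs rs
... | rxs , rys , across = All.++⁻ˡ xs rx ∷ rxs , rys , All.++⁻ʳ xs rx ∷ across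

Unique-++⁻ˡ : ∀ xs {ys : List A} → Unique (xs ++ ys) → Unique xs
Unique-++⁻ˡ xs = proj₁ ∘ AllPairs-++⁻ xs

Unique-++⁻ʳ : ∀ xs {ys : List A} → Unique (xs ++ ys) → Unique ys
Unique-++⁻ʳ xs = proj₁ ∘ proj₂ ∘ AllPairs-++⁻ xs

Unique-++-disjoint : ∀ xs {ys : List A} {x} → Unique (xs ++ ys) → x ∈ xs → x ∈ ys → ⊥
Unique-++-disjoint xs u x∈xs x∈ys =
  All.lookup (All.lookup (proj₂ (proj₂ (AllPairs-++⁻ xs u))) x∈xs) x∈ys refl

module _ {m : ℕ} where

  mutual
    PathTo⇒∈leaves : ∀ {T : Tree m} {y p} → PathTo T y p → y ∈ leaves T
    PathTo⇒∈leaves here           = here refl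
    PathTo⇒∈leaves (down at path) = At⇒∈leavesL at (PathTo⇒∈leaves path)

    At⇒∈leavesL : ∀ {cs : List (Bool × Tree m)} {i b c y} →
      At cs i (b , c) → y ∈ leaves c → y ∈ leavesL cs
    At⇒∈leavesL at-zero                      y∈ = ∈-++⁺ˡ y∈
    At⇒∈leavesL {(_ , c) ∷ _} (at-suc at) y∈ = ∈-++⁺ʳ (leaves c) (At⇒∈leavesL at y∈)

  At-unique-leaves : ∀ {cs : List (Bool × Tree m)} {i b c} →
    Unique (leavesL cs) → At cs i (b , c) → Unique (leaves c)
  At-unique-leaves {(_ , c) ∷ _} u at-zero     = Unique-++⁻ˡ (leaves c) u
  At-unique-leaves {(_ , c) ∷ _} u (at-suc at) = At-unique-leaves (Unique-++⁻ʳ (leaves c) u) at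

  At-unique : ∀ {cs : List (Bool × Tree m)} {i j bc bc′ y} → Unique (leavesL cs) →
    At cs i bc → At cs j bc′ → y ∈ leaves (proj₂ bc) → y ∈ leaves (proj₂ bc′) →
    i ≡ j × bc ≡ bc′
  At-unique _ at-zero at-zero _ _ = refl , refl
  At-unique {(_ , c) ∷ _} u at-zero (at-suc at′) y∈ y∈′ =
    ⊥-elim (Unique-++-disjoint (leaves c) u y∈ (At⇒∈leavesL at′ y∈′))
  At-unique {(_ , c) ∷ _} u (at-suc at) at-zero y∈ y∈′ =
    ⊥-elim (Unique-++-disjoint (leaves c) u y∈′ (At⇒∈leavesL at y∈))
  At-unique {(_ , c) ∷ _} u (at-suc at) (at-suc at′) y∈ y∈′
    with At-unique (Unique-++⁻ʳ (leaves c) u) at at′ y∈ y∈′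
  ... | refl , refl = refl , refl

  PathTo-unique : ∀ {T : Tree m} {y p q} → Unique (leaves T) → PathTo T y p → PathTo T y q → p ≡ q
  PathTo-unique u here here = refl
  PathTo-unique u (down at path) (down at′ path′)
    with At-unique u at at′ (PathTo⇒∈leaves path) (PathTo⇒∈leaves path′)
  ... | refl , refl = cong (_ ∷_) (PathTo-unique (At-unique-leaves u at) path path′)

FitchArc-noInducedTriangle : ∀ {m} {T : Tree m} {x y z} → Unique (leaves T) →
  FitchArc T x y → FitchArc T y z → FitchArc T z x →
  ¬ FitchArc T y x → ¬ FitchArc T z y → ¬ FitchArc T x z → ⊥
FitchArc-noInducedTriangle u
  (x≢y , px , py , Px , Py , xy)
  (y≢z , py′ , pz , Py′ , Pz , yz)
  (z≢x , pz′ , px′ , Pz′ , Px′ , zx)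
  ¬yx ¬zy ¬xz
  with PathTo-unique u Py Py′ | PathTo-unique u Pz Pz′ | PathTo-unique u Px Px′
... | refl | refl | refl =
  belowLca-noTriangle px py pz xy yz zx
    (λ yx → ¬yx (≢-sym x≢y , py , px , Py , Px , yx))
    (λ zy → ¬zy (≢-sym y≢z , pz , py , Pz , Py , zy))
    (λ xz → ¬xz (≢-sym z≢x , px , pz , Px , Pz , xz))

module _ {m : ℕ} where

  caterpillar : Fin m → List (Fin m) → Tree m
  caterpillar h []       = leaf h
  caterpillar h (h′ ∷ t) = node ((false , leaf h) ∷ (true , caterpillar h′ t) ∷ [])

  pattern toPendant = down at-zero here
  pattern toSpine p = down (at-suc at-zero) p

  leaves-caterpillar : ∀ h t → leaves (caterpillar h t) ≡ h ∷ t
  leaves-caterpillar h []       = refl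
  leaves-caterpillar h (h′ ∷ t) =
    cong (h ∷_) (trans (++-identityʳ (leaves (caterpillar h′ t))) (leaves-caterpillar h′ t))

  caterpillar-nonRoot : ∀ h t → NonRootOK (caterpillar h t)
  caterpillar-nonRoot h []       = leafOK h
  caterpillar-nonRoot h (h′ ∷ t) =
    nodeOK _ (s≤s (s≤s z≤n)) (leafOK h ∷ caterpillar-nonRoot h′ t ∷ [])

  caterpillar-rooted : ∀ h t → Unique (h ∷ t) → (∀ x → x ∈ h ∷ t) →
    RootedTreeOn m (caterpillar h t)
  caterpillar-rooted h t u cover = record
    { shape    = shape t
    ; covers   = λ x → subst (x ∈_) (sym (leaves-caterpillar h t)) (cover x)
    ; distinct = subst Unique (sym (leaves-caterpillar h t)) u
    }
    where
    shape : ∀ t → RootOK (caterpillar h t)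
    shape []       = leafOK h
    shape (h′ ∷ t) = nodeOK _ (s≤s z≤n) (leafOK h ∷ caterpillar-nonRoot h′ t ∷ [])

  caterpillar-path : ∀ h t {y} → y ∈ h ∷ t → ∃[ p ] PathTo (caterpillar h t) y p
  caterpillar-path h []       (here refl) = _ , here
  caterpillar-path h (h′ ∷ t) (here refl) = _ , toPendant
  caterpillar-path h (h′ ∷ t) (there y∈)  = _ , toSpine (proj₂ (caterpillar-path h′ t y∈))

  FitchArc-caterpillar⁻ : ∀ {R : Rel (Fin m) ℓ} h t → AllPairs R (h ∷ t) →
    ∀ {x y} → FitchArc (caterpillar h t) x y → R x y
  FitchArc-caterpillar⁻ h [] _ (x≢y , _ , _ , here , here , _) = ⊥-elim (x≢y refl)
  FitchArc-caterpillar⁻ h (h′ ∷ t) _ (x≢y , _ , _ , toPendant , toPendant , _) = ⊥-elim (x≢y refl)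
  FitchArc-caterpillar⁻ h (h′ ∷ t) (Rh ∷ _) (_ , _ , _ , toPendant , toSpine Py , _) =
    All.lookup Rh (subst (_ ∈_) (leaves-caterpillar h′ t) (PathTo⇒∈leaves Py))
  FitchArc-caterpillar⁻ h (h′ ∷ t) _ (_ , _ , _ , toSpine _ , toPendant , here ())
  FitchArc-caterpillar⁻ h (h′ ∷ t) _ (_ , _ , _ , toSpine _ , toPendant , there ())
  FitchArc-caterpillar⁻ h (h′ ∷ t) (_ ∷ Rt) (x≢y , _ , _ , toSpine Px , toSpine Py , one) =
    FitchArc-caterpillar⁻ h′ t Rt (x≢y , _ , _ , Px , Py , one)

  FitchArc-caterpillar⁺ : ∀ {R : Rel (Fin m) ℓ} h t → AllPairs R (h ∷ t) →
    ∀ {x y} → x ∈ h ∷ t → y ∈ h ∷ t → x ≢ y → ¬ R y x → FitchArc (caterpillar h t) x y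
  FitchArc-caterpillar⁺ h t _ (here refl) (here refl) x≢y _ = ⊥-elim (x≢y refl)
  FitchArc-caterpillar⁺ h (h′ ∷ t) _ (here refl) (there y∈) x≢y _ =
    x≢y , _ , _ , toPendant , toSpine (proj₂ (caterpillar-path h′ t y∈)) , here refl
  FitchArc-caterpillar⁺ h (h′ ∷ t) (Rh ∷ _) (there x∈) (here refl) _ ¬Ryx =
    ⊥-elim (¬Ryx (All.lookup Rh x∈))
  FitchArc-caterpillar⁺ h (h′ ∷ t) (_ ∷ Rt) (there x∈) (there y∈) x≢y ¬Ryx
    with FitchArc-caterpillar⁺ h′ t Rt x∈ y∈ x≢y ¬Ryx
  ... | _ , _ , _ , Px , Py , one = x≢y , _ , _ , toSpine Px , toSpine Py , one

transitive⇒acyclic : ∀ {n} {E : Digraph n} → Irreflexive E → Transitive (Arc E) → Acyclic E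
transitive⇒acyclic irr transitive x cycle = irr x (transitive⁻ _ transitive cycle)

module Tournament {n : ℕ} (E : Digraph n)
  (irr : Irreflexive E) (adj : AllAdjacent E) (nob : NoBidirectional E) where

  arc⇒≢ : ∀ {x y} → Arc E x y → x ≢ y
  arc⇒≢ {x} xy refl = irr x xy

  asym : Asymmetric (Arc E)
  asym {x} {y} xy yx = nob x y (arc⇒≢ xy) (xy , yx)

  compare : Trichotomous _≡_ (Arc E)
  compare x y with x ≟ y
  ... | yes refl = tri≈ (irr x) refl (irr x)
  ... | no x≢y with adj x y x≢y
  ...   | inj₁ xy = tri< xy x≢y (asym xy)
  ...   | inj₂ yx = tri> (asym yx) x≢y yx

  triangleFree⇒transitive : (∀ {x y z} → Arc E x y → Arc E y z → ¬ Arc E z x) →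
    Transitive (Arc E)
  triangleFree⇒transitive noTriangle {x} {y} {z} xy yz with compare x z
  ... | tri< xz _ _ = xz
  ... | tri≈ _ refl _ = ⊥-elim (asym xy yz)
  ... | tri> _ _ zx = ⊥-elim (noTriangle xy yz zx)

  acyclic⇒transitive : Acyclic E → Transitive (Arc E)
  acyclic⇒transitive acyclic = triangleFree⇒transitive (λ xy yz zx → acyclic _ (xy ∷ yz ∷ [ zx ]))

  IsFitch⇒transitive : IsFitch E → Transitive (Arc E)
  IsFitch⇒transitive (_ , T , rooted , f , iso) = triangleFree⇒transitive noTriangle
    where
    toFitch : ∀ {x y} → Arc E x y → FitchArc T (Bijection.to f x) (Bijection.to f y)
    toFitch {x} {y} = Equivalence.to (iso x y)

    noTriangle : ∀ {x y z} → Arc E x y → Arc E y z → ¬ Arc E z x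
    noTriangle {x} {y} {z} xy yz zx =
      FitchArc-noInducedTriangle (RootedTreeOn.distinct rooted)
        (toFitch xy) (toFitch yz) (toFitch zx)
        (asym xy ∘ Equivalence.from (iso y x))
        (asym yz ∘ Equivalence.from (iso z y))
        (asym zx ∘ Equivalence.from (iso x z))

  module _ (transitive : Transitive (Arc E)) where

    strictTotalOrder : StrictTotalOrder _ _ _
    strictTotalOrder = record
      { isStrictTotalOrder = record
        { isStrictPartialOrder = record
          { isEquivalence = isEquivalence
          ; irrefl        = λ { refl → irr _ }
          ; trans         = transitive
          ; <-resp-≈      = resp₂ (Arc E)
          }
        ; compare = compare
        }
      }

    open StrictTotalOrderProperties strictTotalOrder using (decTotalOrder; totalOrder)
    open Data.List.Sort decTotalOrder using (sort; sort-↭; sort-↗)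

    ranking : List (Fin n)
    ranking = sort (allFin n)

    ranking-complete : ∀ x → x ∈ ranking
    ranking-complete x = ∈-resp-↭ (↭-sym (sort-↭ (allFin n))) (∈-allFin x)

    ranking-unique : Unique ranking
    ranking-unique =
      ↭ₛ.Unique-resp-↭ (setoid (Fin n)) (↭⇒↭ₛ (↭-sym (sort-↭ (allFin n)))) (allFin⁺ n)

    ranking-sorted : AllPairs (Arc E) ranking
    ranking-sorted =
      AllPairs.zipWith strict (Sorted⇒AllPairs totalOrder (sort-↗ (allFin n)) , ranking-unique)
      where
      strict : ∀ {x y} → (Arc E x y ⊎ x ≡ y) × x ≢ y → Arc E x y
      strict (inj₁ xy , _)   = xy
      strict (inj₂ x≡y , x≢y) = ⊥-elim (x≢y x≡y)

    transitive⇒IsFitch : Fin n → IsFitch E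
    transitive⇒IsFitch v with ranking | ranking-complete | ranking-unique | ranking-sorted
    ... | [] | complete | _ | _ with () ← complete v
    ... | h ∷ t | complete | u | sorted =
      n , caterpillar h t , caterpillar-rooted h t u complete , ⤖-id (Fin n) , λ x y →
        mk⇔ (λ xy → FitchArc-caterpillar⁺ h t sorted (complete x) (complete y) (arc⇒≢ xy) (asym xy))
            (FitchArc-caterpillar⁻ h t sorted)

corollary2 : (n : ℕ) → 0 < n → (E : Digraph n) → Irreflexive E →
             AllAdjacent E → NoBidirectional E →
             (IsFitch E ⇔ Acyclic E)
corollary2 (suc n) _ E irr adj nob =
  mk⇔ (transitive⇒acyclic irr ∘ IsFitch⇒transitive)
      (λ acyclic → transitive⇒IsFitch (acyclic⇒transitive acyclic) fzero)
  where open Tournament E irr adj nob
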